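{- For all integers $k\ge 1$ and $\ell\ge 0$, there are only finitely many (up to isomorphism) $k$-vertex-critical graphs that are both $(P_4+\ell P_1)$-free and $2P_2$-free.
   Context: All graphs are finite and simple. A graph $G$ is $k$-vertex-critical if $\chi(G)=k$ but $\chi(G-v)<k$ for every $v\in V(G)$. A graph is $H$-free if it has no induced subgraph isomorphic to $H$. $P_n$ is the path on $n$ vertices, $P_1$ a single vertex, $+$ denotes disjoint union, $\ell P_1$ is $\ell$ isolated vertices, and $2P_2$ is the disjoint union of two edges. -}

module Defs where

open import Data.Nat using (ℕ; zero; suc; _+_; _∸_)
open import Data.Fin using (Fin; toℕ)
open import Data.Bool using (Bool; true; false)
open import Data.Product using (Σ; _×_; ∃; _,_)
open import Data.List using (List)
open import Data.List.Relation.Unary.Any using (Any)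
open import Function.Bundles using (_↔_; Inverse)
open import Relation.Binary.PropositionalEquality using (_≡_; _≢_)
open import Relation.Nullary using (¬_)
open import Data.Unit using (⊤)

record Graph (n : ℕ) : Set where
  field
    adj    : Fin n → Fin n → Bool
    sym    : ∀ x y → adj x y ≡ adj y x
    irrefl : ∀ x → adj x x ≡ false
open Graph public

ColourableOn : {n : ℕ} → Graph n → (Fin n → Set) → ℕ → Set
ColourableOn {n} G P m =
  Σ ((x : Fin n) → P x → Fin m) λ c →
    ∀ x y (px : P x) (py : P y) → adj G x y ≡ true → c x px ≢ c y py

Colourable : {n : ℕ} → Graph n → ℕ → Set
Colourable G m = ColourableOn G (λ _ → ⊤) m

ChromaticNumber : {n : ℕ} → Graph n → ℕ → Set
ChromaticNumber G k = Colourable G k × ¬ Colourable G (k ∸ 1)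

-- G is k-vertex-critical: χ(G) = k and χ(G - v) < k (i.e. G - v is
-- (k-1)-colourable) for every vertex v.  Used only with k ≥ 1.
VertexCritical : {n : ℕ} → Graph n → ℕ → Set
VertexCritical {n} G k =
  ChromaticNumber G k × (∀ (v : Fin n) → ColourableOn G (λ x → x ≢ v) (k ∸ 1))

ContainsInduced : {n h : ℕ} → Graph n → (Fin h → Fin h → Bool) → Set
ContainsInduced {n} {h} G H =
  Σ (Fin h → Fin n) λ f →
    (∀ i j → f i ≡ f j → i ≡ j) × (∀ i j → adj G (f i) (f j) ≡ H i j)

Free : {n h : ℕ} → Graph n → (Fin h → Fin h → Bool) → Set
Free G H = ¬ ContainsInduced G H

p4edge : ℕ → ℕ → Bool
p4edge 0 1 = true
p4edge 1 0 = true
p4edge 1 2 = true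
p4edge 2 1 = true
p4edge 2 3 = true
p4edge 3 2 = true
p4edge _ _ = false

-- P4 + ℓP1 on vertices Fin (4 + ℓ): path 0-1-2-3, vertices ≥ 4 isolated.
P4+ℓP1 : (ℓ : ℕ) → Fin (4 + ℓ) → Fin (4 + ℓ) → Bool
P4+ℓP1 ℓ i j = p4edge (toℕ i) (toℕ j)

twoP2edge : ℕ → ℕ → Bool
twoP2edge 0 1 = true
twoP2edge 1 0 = true
twoP2edge 2 3 = true
twoP2edge 3 2 = true
twoP2edge _ _ = false

2P2 : Fin 4 → Fin 4 → Bool
2P2 i j = twoP2edge (toℕ i) (toℕ j)

Isomorphic : {n m : ℕ} → Graph n → Graph m → Set
Isomorphic {n} {m} G H =
  Σ (Fin n ↔ Fin m) λ φ →
    ∀ x y → adj H (Inverse.to φ x) (Inverse.to φ y) ≡ adj G x y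

AnyGraph : Set
AnyGraph = Σ ℕ Graph

-- By Ramsey's theorem it suffices to bound the independent sets of such a graph G,
-- since χ(G) = k excludes cliques of size k + 1. Let I be independent. Vertex-criticality
-- forbids N(u) ⊆ N(v) for distinct u, v, so for distinct u, v ∈ I some vertex sees u but
-- not v. Call x, y incomparable (relative to I) if each has a neighbour a resp. b in I
-- that the other misses. Then x ~ y, or a, x, b, y induce 2P2; and fewer than ℓ vertices
-- of I miss both x and y, or they induce P4 + ℓP1 together with the path a x y b.
-- Take z with an inclusion-minimal neighbourhood in I. If that neighbourhood is large,
-- recurse into it among the vertices incomparable with z. Otherwise a second minimal
-- vertex r, chosen to miss a neighbour of z, is incomparable with z, so I is covered by
-- two small neighbourhoods and fewer than ℓ common non-neighbours; hence |I| ≥ f(k),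
-- with f(0) = 2 and f(k+1) = 2 f(k) + ℓ, yields k + 1 pairwise incomparable, so
-- pairwise adjacent, vertices, which is impossible.
module Submission where

open import Defs
open import Level using (Level; 0ℓ)
open import Data.Bool using (Bool; true; false; _∧_; if_then_else_)
open import Data.Bool.Properties using (¬-not; ∧-comm; ∧-idem)
import Data.Bool as Bool
open import Data.Empty using (⊥)
open import Data.Fin using (Fin; zero; suc; toℕ; splitAt; join; inject≤)
  renaming (_<_ to _<ᶠ_)
import Data.Fin.Properties as Fin
open import Data.Fin.Patterns using (0F; 1F; 2F; 3F)
open import Data.List using (List; []; _∷_; length; lookup; filter; allFin; upTo; map;
  concatMap; cartesianProductWith)
open import Data.List.Properties using (length-tabulate)
open import Data.List.Membership.Propositional using (_∈_; find; lose)
open import Data.List.Membership.Propositional.Properties using (∈-filter⁻; ∈-lookup)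
open import Data.List.Relation.Unary.All as All using (All; []; _∷_)
open import Data.List.Relation.Unary.All.Properties using (all-filter)
open import Data.List.Relation.Unary.Any as Any using (Any; here; there)
open import Data.List.Relation.Unary.Any.Properties
  using (concatMap⁺; applyUpTo⁺; map⁺; cartesianProductWith⁺)
  renaming (filter⁻ to Any-filter⁻)
open import Data.List.Relation.Unary.AllPairs as AllPairs using (AllPairs; []; _∷_)
open import Data.List.Relation.Unary.Unique.Propositional using (Unique)
import Data.List.Relation.Unary.Unique.Propositional.Properties as Unique
open import Data.List.Relation.Binary.Sublist.Propositional
  using (_⊆_; []; _∷_; _∷ʳ_; minimum; ⊆-trans)
open import Data.List.Relation.Binary.Sublist.Propositional.Properties
  using (All-resp-⊆; filter-⊆; length-mono-≤)
  renaming (filter⁺ to ⊆-filter⁺)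
open import Data.Nat using (ℕ; zero; suc; _+_; _≤_; _<_; _≥_; z≤n; s≤s; _≤?_)
open import Data.Nat.Induction using (<-wellFounded)
open import Data.Nat.Properties
open import Data.Product using (Σ; ∃; ∃-syntax; _×_; _,_; proj₁; proj₂)
import Data.Product as Product
open import Data.Sum using (_⊎_; inj₁; inj₂; [_,_]′)
import Data.Sum as Sum
open import Data.Unit using (⊤; tt)
import Data.Vec.Functional as Vector
open import Function using (_∘_; id; const)
open import Function.Construct.Identity using (↔-id)
open import Induction.WellFounded using (Acc; acc)
open import Relation.Binary using (Rel; Reflexive; Symmetric; DecidableEquality; tri<; tri≈; tri>)
  renaming (Decidable to Decidable₂)
open import Relation.Binary.PropositionalEquality as ≡
  using (_≡_; _≢_; refl; cong; cong₂; subst; subst₂; module ≡-Reasoning)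
open import Relation.Nullary using (¬_; Dec; yes; no; does; contradiction)
open import Relation.Nullary.Decidable using (¬?; _×-dec_; _→-dec_; toWitness)
open import Relation.Unary using (Pred; Decidable)

private
  variable
    a p q r : Level
    A : Set a
    x y : A
    xs ys : List A

count : {P : Pred A p} → Decidable P → List A → ℕ
count P? xs = length (filter P? xs)

module _ {P : Pred A p} (P? : Decidable P) where

  count-∁ : ∀ xs → length xs ≡ count P? xs + count (¬? ∘ P?) xs
  count-∁ [] = refl
  count-∁ (x ∷ xs) with P? x
  ... | yes _ = cong suc (count-∁ xs)
  ... | no _  = ≡.trans (cong suc (count-∁ xs)) (≡.sym (+-suc _ _))

module _ {P : Pred A p} {Q : Pred A q} (P? : Decidable P) (Q? : Decidable Q) where

  neither? : Decidable (λ x → ¬ P x × ¬ Q x)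
  neither? x = ¬? (P? x) ×-dec ¬? (Q? x)

  count-mono : All (λ x → P x → Q x) xs → count P? xs ≤ count Q? xs
  count-mono {xs = []} [] = z≤n
  count-mono {xs = x ∷ xs} (P⇒Q ∷ rest) with P? x | Q? x
  ... | yes _  | yes _   = s≤s (count-mono rest)
  ... | yes px | no ¬qx  = contradiction (P⇒Q px) ¬qx
  ... | no _   | yes _   = m≤n⇒m≤1+n (count-mono rest)
  ... | no _   | no _    = count-mono rest

  count-strict : All (λ x → P x → Q x) xs → Any (λ x → Q x × ¬ P x) xs →
                 count P? xs < count Q? xs
  count-strict {xs = x ∷ xs} (P⇒Q ∷ rest) (here (qx , ¬px)) with P? x | Q? x
  ... | yes px | _      = contradiction px ¬px
  ... | no _   | yes _  = s≤s (count-mono rest)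
  ... | no _   | no ¬qx = contradiction qx ¬qx
  count-strict {xs = x ∷ xs} (P⇒Q ∷ rest) (there w) with P? x | Q? x
  ... | yes _  | yes _  = s≤s (count-strict rest w)
  ... | yes px | no ¬qx = contradiction (P⇒Q px) ¬qx
  ... | no _   | yes _  = m≤n⇒m≤1+n (count-strict rest w)
  ... | no _   | no _   = count-strict rest w

  count-cover : ∀ xs → length xs ≤ count P? xs + count Q? xs + count neither? xs
  count-cover [] = z≤n
  count-cover (x ∷ xs) with count-cover xs | P? x | Q? x
  ... | ih | yes _ | yes _ = s≤s (≤-trans ih (+-monoˡ-≤ (count neither? xs)
                                                (+-monoʳ-≤ (count P? xs) (n≤1+n _))))
  ... | ih | yes _ | no _  = s≤s ih
  ... | ih | no _  | yes _ = ≤-trans (s≤s ih) (≤-reflexive (cong (_+ count neither? xs)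
                                                (≡.sym (+-suc (count P? xs) (count Q? xs)))))
  ... | ih | no _  | no _  = ≤-trans (s≤s ih) (≤-reflexive (≡.sym (+-suc _ _)))

module _ {R : Rel A r} where

  AllPairs-resp-⊆ : ys ⊆ xs → AllPairs R xs → AllPairs R ys
  AllPairs-resp-⊆ [] [] = []
  AllPairs-resp-⊆ (_ ∷ʳ τ) (_ ∷ rs) = AllPairs-resp-⊆ τ rs
  AllPairs-resp-⊆ (refl ∷ τ) (r ∷ rs) = All-resp-⊆ τ r ∷ AllPairs-resp-⊆ τ rs

  AllPairs-lookup : AllPairs R xs → ∀ {i j} → i <ᶠ j → R (lookup xs i) (lookup xs j)
  AllPairs-lookup (r ∷ _)  {zero}  {suc j} _         = All.lookup r (∈-lookup j)
  AllPairs-lookup (_ ∷ rs) {suc i} {suc j} (s≤s i<j) = AllPairs-lookup rs i<j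

  AllPairs-∈ : Reflexive R → Symmetric R → AllPairs R xs → x ∈ xs → y ∈ xs → R x y
  AllPairs-∈ R-refl R-sym (r ∷ rs) (here refl) (here refl) = R-refl
  AllPairs-∈ R-refl R-sym (r ∷ rs) (here refl) (there y∈)  = All.lookup r y∈
  AllPairs-∈ R-refl R-sym (r ∷ rs) (there x∈)  (here refl) = R-sym (All.lookup r x∈)
  AllPairs-∈ R-refl R-sym (r ∷ rs) (there x∈)  (there y∈)  = AllPairs-∈ R-refl R-sym rs x∈ y∈

Unique-lookup-injective : Unique xs → ∀ {i j} → lookup xs i ≡ lookup xs j → i ≡ j
Unique-lookup-injective u {i} {j} eq with Fin.<-cmp i j
... | tri< i<j _ _ = contradiction eq (AllPairs-lookup u i<j)
... | tri≈ _ i≡j _ = i≡j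
... | tri> _ _ j<i = contradiction (≡.sym eq) (AllPairs-lookup u j<i)

∈-≢-exists : {A : Set a} → DecidableEquality A → {xs : List A} → Unique xs → 2 ≤ length xs →
             ∀ x → ∃[ y ] y ∈ xs × y ≢ x
∈-≢-exists _≟_ {_ ∷ []} _ (s≤s ()) _
∈-≢-exists _≟_ {y ∷ z ∷ _} (y∉ ∷ _) _ x with y ≟ x
... | no y≢x   = y , here refl , y≢x
... | yes refl = z , there (here refl) , All.lookup y∉ (here refl) ∘ ≡.sym

-- Ramsey's theorem

-- The Erdős–Szekeres recursion; it is an upper bound for, not the value of, R(a, b).
ramseyBound : ℕ → ℕ → ℕ
ramseyBound zero    b       = 0
ramseyBound (suc a) zero    = 0
ramseyBound (suc a) (suc b) = suc (ramseyBound a (suc b) + ramseyBound (suc a) b)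

Homogeneous : Rel A r → ℕ → List A → Set _
Homogeneous R m xs = ∃[ ys ] ys ⊆ xs × length ys ≡ m × AllPairs R ys

module _ {s} {S : Rel A s} where

  Homogeneous-⊆ : ys ⊆ xs → ∀ {m} → Homogeneous S m ys → Homogeneous S m xs
  Homogeneous-⊆ τ (zs , σ , len , hom) = zs , ⊆-trans σ τ , len , hom

  Homogeneous-∷ : {P : Pred A p} (P? : Decidable P) → (∀ {y} → P y → S x y) →
                  ∀ {m} → Homogeneous S m (filter P? xs) → Homogeneous S (suc m) (x ∷ xs)
  Homogeneous-∷ {xs = xs} P? P⇒S (zs , σ , refl , hom) =
    _ ∷ zs , refl ∷ ⊆-trans σ (filter-⊆ P? xs) , refl ,
    All.map P⇒S (All-resp-⊆ σ (all-filter P? xs)) ∷ hom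

ramsey : {R : Rel A r} → Decidable₂ R → ∀ a b xs → ramseyBound a b ≤ length xs →
         Homogeneous R a xs ⊎ Homogeneous (λ x y → ¬ R x y) b xs
ramsey R? zero    b       xs _ = inj₁ ([] , minimum xs , refl , [])
ramsey R? (suc a) zero    xs _ = inj₂ ([] , minimum xs , refl , [])
ramsey R? (suc a) (suc b) (x ∷ xs) (s≤s big) with ramseyBound a (suc b) ≤? count (R? x) xs
... | yes many-related =
  Sum.map (Homogeneous-∷ (R? x) id) (Homogeneous-⊆ (x ∷ʳ filter-⊆ (R? x) xs))
          (ramsey R? a (suc b) _ many-related)
... | no few-related =
  Sum.map (Homogeneous-⊆ (x ∷ʳ filter-⊆ (¬? ∘ R? x) xs)) (Homogeneous-∷ (¬? ∘ R? x) id)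
          (ramsey R? (suc a) b _ many-unrelated)
  where
  many-unrelated : ramseyBound (suc a) b ≤ count (¬? ∘ R? x) xs
  many-unrelated = <⇒≤ (+-cancelˡ-< (count (R? x) xs) _ _ (<-≤-trans
    (+-monoˡ-< _ (≰⇒> few-related))
    (subst (_ ≤_) (count-∁ (R? x) xs) big)))

-- Incomparable vertices relative to a list of vertices

threshold : ℕ → ℕ → ℕ
threshold ℓ zero    = 2
threshold ℓ (suc k) = threshold ℓ k + threshold ℓ k + ℓ

2≤threshold : ∀ ℓ k → 2 ≤ threshold ℓ k
2≤threshold ℓ zero    = ≤-refl
2≤threshold ℓ (suc k) = ≤-trans (2≤threshold ℓ k) (≤-trans (m≤m+n _ _) (m≤m+n _ ℓ))

module Incomparability {n : ℕ} {_~_ : Rel (Fin n) 0ℓ} (_~?_ : Decidable₂ _~_) where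

  Vertices : Set
  Vertices = List (Fin n)

  HasNeighbourIn : Vertices → Pred (Fin n) 0ℓ
  HasNeighbourIn J x = Any (x ~_) J

  _⊑[_]_ : Fin n → Vertices → Fin n → Set
  x ⊑[ J ] z = All (λ a → x ~ a → z ~ a) J

  PrivateNeighbour : Vertices → Fin n → Fin n → Set
  PrivateNeighbour J x z = Any (λ a → x ~ a × ¬ z ~ a) J

  Incomparable : Vertices → Rel (Fin n) 0ℓ
  Incomparable J x y = PrivateNeighbour J x y × PrivateNeighbour J y x

  degree : Vertices → Fin n → ℕ
  degree J x = count (x ~?_) J

  commonNonNeighbours : Vertices → Fin n → Fin n → Vertices
  commonNonNeighbours J x y = filter (neither? (x ~?_) (y ~?_)) J

  Minimal : Pred (Fin n) 0ℓ → Vertices → Fin n → Set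
  Minimal X J z = ∀ {x} → X x → HasNeighbourIn J x → x ⊑[ J ] z → z ⊑[ J ] x

  Separated : Pred (Fin n) 0ℓ → Vertices → Set
  Separated X J = ∀ {u v} → u ∈ J → v ∈ J → u ≢ v → ∃[ x ] X x × x ~ u × ¬ x ~ v

  FewCommonNonNeighbours : ℕ → Vertices → Set
  FewCommonNonNeighbours ℓ J =
    ∀ {x y} → Incomparable J x y → length (commonNonNeighbours J x y) < ℓ

  IncomparableFamily : Pred (Fin n) 0ℓ → Vertices → ℕ → Set
  IncomparableFamily X J m = ∃[ C ] length C ≡ m × All X C × AllPairs (Incomparable J) C

  HasNeighbourIn? : ∀ J → Decidable (HasNeighbourIn J)
  HasNeighbourIn? J x = Any.any? (x ~?_) J

  ⊑? : ∀ J x z → Dec (x ⊑[ J ] z)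
  ⊑? J x z = All.all? (λ a → x ~? a →-dec z ~? a) J

  PrivateNeighbour? : ∀ J x z → Dec (PrivateNeighbour J x z)
  PrivateNeighbour? J x z = Any.any? (λ a → x ~? a ×-dec ¬? (z ~? a)) J

  Incomparable? : ∀ J → Decidable₂ (Incomparable J)
  Incomparable? J x y = PrivateNeighbour? J x y ×-dec PrivateNeighbour? J y x

  ⊑-refl : ∀ J x → x ⊑[ J ] x
  ⊑-refl J x = All.universal (λ _ → id) J

  ⊑-trans : ∀ {J x y z} → x ⊑[ J ] y → y ⊑[ J ] z → x ⊑[ J ] z
  ⊑-trans x⊑y y⊑z = All.zipWith (λ (f , g) → g ∘ f) (x⊑y , y⊑z)

  ⊑-or-private : ∀ J x z → x ⊑[ J ] z ⊎ PrivateNeighbour J x z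
  ⊑-or-private []      x z = inj₁ []
  ⊑-or-private (a ∷ J) x z with x ~? a | z ~? a | ⊑-or-private J x z
  ... | yes xa  | no ¬za | _       = inj₂ (here (xa , ¬za))
  ... | _       | _      | inj₂ pn = inj₂ (there pn)
  ... | no ¬xa  | _      | inj₁ x⊑z = inj₁ ((λ xa → contradiction xa ¬xa) ∷ x⊑z)
  ... | yes _   | yes za | inj₁ x⊑z = inj₁ (const za ∷ x⊑z)

  degree-strict : ∀ {J x z} → x ⊑[ J ] z → PrivateNeighbour J z x → degree J x < degree J z
  degree-strict {x = x} {z} = count-strict (x ~?_) (z ~?_)

  incomparable-filter⁻ : ∀ {P : Pred (Fin n) 0ℓ} (P? : Decidable P) {J x y} →
                         Incomparable (filter P? J) x y → Incomparable J x y
  incomparable-filter⁻ P? = Product.map (Any-filter⁻ P?) (Any-filter⁻ P?)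

  few-filter : ∀ {ℓ} {P : Pred (Fin n) 0ℓ} (P? : Decidable P) {J} →
               FewCommonNonNeighbours ℓ J → FewCommonNonNeighbours ℓ (filter P? J)
  few-filter P? {J} few {x} {y} inc = ≤-<-trans
    (length-mono-≤ (⊆-filter⁺ (neither? (x ~?_) (y ~?_)) _ (λ { refl → id }) (filter-⊆ P? J)))
    (few (incomparable-filter⁻ P? inc))

  minimal-below : ∀ {X} → Decidable X → ∀ J {z₀} → X z₀ → HasNeighbourIn J z₀ →
                  ∃[ z ] X z × HasNeighbourIn J z × z ⊑[ J ] z₀ × Minimal X J z
  minimal-below {X} X? J {z₀} = descend z₀ (<-wellFounded (degree J z₀))
    where
    descend : ∀ z₁ → Acc _<_ (degree J z₁) → X z₁ → HasNeighbourIn J z₁ →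
              ∃[ z ] X z × HasNeighbourIn J z × z ⊑[ J ] z₁ × Minimal X J z
    descend z₁ (acc smaller) Xz₁ nz₁ with Fin.any? (λ x → X? x ×-dec HasNeighbourIn? J x
                                                    ×-dec ⊑? J x z₁ ×-dec PrivateNeighbour? J z₁ x)
    ... | yes (x , Xx , nx , x⊑z₁ , pn) =
      let z , Xz , nz , z⊑x , z-minimal = descend x (smaller (degree-strict x⊑z₁ pn)) Xx nx
      in  z , Xz , nz , ⊑-trans z⊑x x⊑z₁ , z-minimal
    ... | no nothing-below = z₁ , Xz₁ , nz₁ , ⊑-refl J z₁ , λ {x} Xx nx x⊑z₁ →
      [ id , (λ pn → contradiction (x , Xx , nx , x⊑z₁ , pn) nothing-below) ]′ (⊑-or-private J z₁ x)

  minimal-avoiding : ∀ {X} → Decidable X → ∀ {J} → Unique J → 2 ≤ length J → Separated X J →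
                     ∀ {a} → a ∈ J → ∃[ r ] X r × HasNeighbourIn J r × ¬ r ~ a × Minimal X J r
  minimal-avoiding X? {J} unique 2≤|J| separated {a} a∈J =
    let b , b∈J , b≢a           = ∈-≢-exists Fin._≟_ unique 2≤|J| a
        s , Xs , sb , ¬sa       = separated b∈J a∈J b≢a
        r , Xr , nr , r⊑s , r-minimal = minimal-below X? J Xs (lose b∈J sb)
    in  r , Xr , nr , ¬sa ∘ All.lookup r⊑s a∈J , r-minimal

  minimal-incomparable : ∀ {X J z r a} → Minimal X J z → X r → HasNeighbourIn J r →
                         a ∈ J → z ~ a → ¬ r ~ a → Incomparable J z r
  minimal-incomparable {J = J} {z} {r} z-minimal Xr nr a∈J za ¬ra =
    lose a∈J (za , ¬ra) ,
    [ (λ r⊑z → contradiction (All.lookup (z-minimal Xr nr r⊑z) a∈J za) ¬ra) , id ]′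
      (⊑-or-private J r z)

  separated-neighbourhood : ∀ {X J w} → Minimal X J w → Separated X J →
                            Separated (λ x → X x × Incomparable J w x) (filter (w ~?_) J)
  separated-neighbourhood {w = w} w-minimal separated u∈ v∈ u≢v =
    let u∈J , _  = ∈-filter⁻ (w ~?_) u∈
        v∈J , wv = ∈-filter⁻ (w ~?_) v∈
        x , Xx , xu , ¬xv = separated u∈J v∈J u≢v
    in  x , (Xx , minimal-incomparable w-minimal Xx (lose u∈J xu) v∈J wv ¬xv) , xu , ¬xv

  family-∷ : ∀ {X J w m} → X w →
             IncomparableFamily (λ x → X x × Incomparable J w x) (filter (w ~?_) J) m →
             IncomparableFamily X J (suc m)
  family-∷ {w = w} Xw (C , refl , XC , pairs) =
    w ∷ C , refl , Xw ∷ All.map proj₁ XC ,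
    All.map proj₂ XC ∷ AllPairs.map (incomparable-filter⁻ (w ~?_)) pairs

  incomparable-family : ∀ ℓ k {X} → Decidable X → ∀ {J} → Unique J → threshold ℓ k ≤ length J →
                        Separated X J → FewCommonNonNeighbours ℓ J → IncomparableFamily X J (suc k)
  family-in-neighbourhood : ∀ ℓ k {X} → Decidable X → ∀ {J} → Unique J → Separated X J →
                            FewCommonNonNeighbours ℓ J → ∀ {w} → X w → Minimal X J w →
                            threshold ℓ k ≤ degree J w → IncomparableFamily X J (suc (suc k))

  family-in-neighbourhood ℓ k X? {J} unique separated few {w} Xw w-minimal large =
    family-∷ Xw (incomparable-family ℓ k (λ x → X? x ×-dec Incomparable? J w x)
                   (Unique.filter⁺ (w ~?_) unique) large
                   (separated-neighbourhood w-minimal separated) (few-filter (w ~?_) few))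

  incomparable-family ℓ k X? {[]} _ large _ _ =
    contradiction (≤-trans (2≤threshold ℓ k) large) λ ()
  incomparable-family ℓ zero X? {_ ∷ _} unique large separated _ =
    let r , Xr , _ = minimal-avoiding X? unique large separated (here refl)
    in  r ∷ [] , refl , Xr ∷ [] , [] ∷ []
  incomparable-family ℓ (suc k) X? {J@(_ ∷ _)} unique large separated few
    with ≤-trans (2≤threshold ℓ (suc k)) large
  ... | 2≤|J| with minimal-avoiding X? unique 2≤|J| separated (here refl)
  ... | z , Xz , nz , _ , z-minimal with threshold ℓ k ≤? degree J z
  ... | yes z-large = family-in-neighbourhood ℓ k X? unique separated few Xz z-minimal z-large
  ... | no z-small with find nz
  ... | a′ , a′∈J , za′ with minimal-avoiding X? unique 2≤|J| separated a′∈J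
  ... | r , Xr , nr , ¬ra′ , r-minimal with threshold ℓ k ≤? degree J r
  ... | yes r-large = family-in-neighbourhood ℓ k X? unique separated few Xr r-minimal r-large
  ... | no r-small = contradiction large (<⇒≱ (≤-<-trans (count-cover (z ~?_) (r ~?_) J)
        (+-mono-< (+-mono-< (≰⇒> z-small) (≰⇒> r-small))
                  (few (minimal-incomparable z-minimal Xr nr a′∈J za′ ¬ra′)))))

-- Induced subgraphs

P4 : Fin 4 → Fin 4 → Bool
P4 i j = p4edge (toℕ i) (toℕ j)

TwinFree : ∀ {h} → (Fin h → Fin h → Bool) → Set
TwinFree H = ∀ i j → (∀ k → H i k ≡ H j k) → i ≡ j

twinFree? : ∀ {h} (H : Fin h → Fin h → Bool) → Dec (TwinFree H)
twinFree? H = Fin.all? λ i → Fin.all? λ j → Fin.all? (λ k → H i k Bool.≟ H j k) →-dec i Fin.≟ j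

P4-twinFree : TwinFree P4
P4-twinFree = toWitness {a? = twinFree? P4} tt

2P2-twinFree : TwinFree 2P2
2P2-twinFree = toWitness {a? = twinFree? 2P2} tt

P4-neighbour : ∀ i → ∃[ j ] P4 i j ≡ true
P4-neighbour 0F = 1F , refl
P4-neighbour 1F = 0F , refl
P4-neighbour 2F = 3F , refl
P4-neighbour 3F = 2F , refl

module _ {n : ℕ} (G : Graph n) where

  _~_ : Rel (Fin n) 0ℓ
  x ~ y = adj G x y ≡ true

  _~?_ : Decidable₂ _~_
  x ~? y = adj G x y Bool.≟ true

  flip-adj : ∀ {x y b} → adj G x y ≡ b → adj G y x ≡ b
  flip-adj {x} {y} xy = ≡.trans (sym G y x) xy

  ~-sym : Symmetric _~_
  ~-sym = flip-adj

  ~-irrefl : ∀ {x} → ¬ x ~ x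
  ~-irrefl {x} xx = contradiction (≡.trans (≡.sym xx) (irrefl G x)) λ ()

  Embeds : ∀ {h} → (Fin h → Fin n) → (Fin h → Fin h → Bool) → Set
  Embeds f H = ∀ i j → adj G (f i) (f j) ≡ H i j

  embedding-injective : ∀ {h} {H : Fin h → Fin h → Bool} {f} → TwinFree H → Embeds f H →
                        ∀ i j → f i ≡ f j → i ≡ j
  embedding-injective {f = f} twinFree embeds i j fi≡fj = twinFree i j λ k →
    ≡.trans (≡.sym (embeds i k)) (≡.trans (cong (λ v → adj G v (f k)) fi≡fj) (embeds j k))

  induced : ∀ {h} {H : Fin h → Fin h → Bool} → TwinFree H → ∀ f → Embeds f H → ContainsInduced G H
  induced twinFree f embeds = f , embedding-injective twinFree embeds , embeds

  quad : Fin n → Fin n → Fin n → Fin n → Fin 4 → Fin n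
  quad a x y b 0F = a
  quad a x y b 1F = x
  quad a x y b 2F = y
  quad a x y b 3F = b

  path-embeds : ∀ {a x y b} → a ~ x → x ~ y → y ~ b → ¬ a ~ y → ¬ x ~ b → ¬ a ~ b →
                Embeds (quad a x y b) P4
  path-embeds {a} {x} {y} {b} ax xy yb ¬ay ¬xb ¬ab = λ where
    0F 0F → irrefl G a
    0F 1F → ax
    0F 2F → ¬-not ¬ay
    0F 3F → ¬-not ¬ab
    1F 0F → flip-adj ax
    1F 1F → irrefl G x
    1F 2F → xy
    1F 3F → ¬-not ¬xb
    2F 0F → flip-adj (¬-not ¬ay)
    2F 1F → flip-adj xy
    2F 2F → irrefl G y
    2F 3F → yb
    3F 0F → flip-adj (¬-not ¬ab)
    3F 1F → flip-adj (¬-not ¬xb)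
    3F 2F → flip-adj yb
    3F 3F → irrefl G b

  2P2-embeds : ∀ {a x y b} → a ~ x → y ~ b → ¬ a ~ y → ¬ a ~ b → ¬ x ~ y → ¬ x ~ b →
               Embeds (quad a x y b) 2P2
  2P2-embeds {a} {x} {y} {b} ax yb ¬ay ¬ab ¬xy ¬xb = λ where
    0F 0F → irrefl G a
    0F 1F → ax
    0F 2F → ¬-not ¬ay
    0F 3F → ¬-not ¬ab
    1F 0F → flip-adj ax
    1F 1F → irrefl G x
    1F 2F → ¬-not ¬xy
    1F 3F → ¬-not ¬xb
    2F 0F → flip-adj (¬-not ¬ay)
    2F 1F → flip-adj (¬-not ¬xy)
    2F 2F → irrefl G y
    2F 3F → yb
    3F 0F → flip-adj (¬-not ¬ab)
    3F 1F → flip-adj (¬-not ¬xb)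
    3F 2F → flip-adj yb
    3F 3F → irrefl G b

  P4+isolated : ∀ ℓ {f : Fin 4 → Fin n} {w : Fin ℓ → Fin n} → Embeds f P4 →
                (∀ i j → w i ≡ w j → i ≡ j) → (∀ i j → ¬ w i ~ w j) → (∀ i j → ¬ f i ~ w j) →
                ContainsInduced G (P4+ℓP1 ℓ)
  P4+isolated ℓ {f} {w} f-embeds w-injective w-independent f≁w = g , g-injective , g-embeds
    where
    fw : Fin 4 ⊎ Fin ℓ → Fin n
    fw = [ f , w ]′

    g : Fin (4 + ℓ) → Fin n
    g i = fw (splitAt 4 i)

    fw-embeds : ∀ s t → adj G (fw s) (fw t) ≡ P4+ℓP1 ℓ (join 4 ℓ s) (join 4 ℓ t)
    fw-embeds (inj₁ i) (inj₁ j) rewrite Fin.toℕ-↑ˡ i ℓ | Fin.toℕ-↑ˡ j ℓ = f-embeds i j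
    fw-embeds (inj₁ 0F) (inj₂ j) = ¬-not (f≁w 0F j)
    fw-embeds (inj₁ 1F) (inj₂ j) = ¬-not (f≁w 1F j)
    fw-embeds (inj₁ 2F) (inj₂ j) = ¬-not (f≁w 2F j)
    fw-embeds (inj₁ 3F) (inj₂ j) = ¬-not (f≁w 3F j)
    fw-embeds (inj₂ i) (inj₁ j) = ¬-not (f≁w j i ∘ ~-sym)
    fw-embeds (inj₂ i) (inj₂ j) = ¬-not (w-independent i j)

    g-embeds : Embeds g (P4+ℓP1 ℓ)
    g-embeds i j = subst₂ (λ i′ j′ → adj G (g i) (g j) ≡ P4+ℓP1 ℓ i′ j′)
      (Fin.join-splitAt 4 ℓ i) (Fin.join-splitAt 4 ℓ j) (fw-embeds (splitAt 4 i) (splitAt 4 j))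

    -- A path vertex has a neighbour on the path, an isolated vertex has none.
    f≢w : ∀ i j → f i ≢ w j
    f≢w i j fi≡wj = let i′ , ii′ = P4-neighbour i in
      f≁w i′ j (~-sym (subst (_~ f i′) fi≡wj (≡.trans (f-embeds i i′) ii′)))

    fw-injective : ∀ s t → fw s ≡ fw t → s ≡ t
    fw-injective (inj₁ i) (inj₁ j) eq = cong inj₁ (embedding-injective P4-twinFree f-embeds i j eq)
    fw-injective (inj₁ i) (inj₂ j) eq = contradiction eq (f≢w i j)
    fw-injective (inj₂ i) (inj₁ j) eq = contradiction (≡.sym eq) (f≢w j i)
    fw-injective (inj₂ i) (inj₂ j) eq = cong inj₂ (w-injective i j eq)

    g-injective : ∀ i j → g i ≡ g j → i ≡ j
    g-injective i j eq = ≡.trans (≡.sym (Fin.join-splitAt 4 ℓ i))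
      (≡.trans (cong (join 4 ℓ) (fw-injective (splitAt 4 i) (splitAt 4 j) eq))
                (Fin.join-splitAt 4 ℓ j))

  open Incomparability _~?_

  Independent : Vertices → Set
  Independent I = ∀ {u v} → u ∈ I → v ∈ I → ¬ u ~ v

  incomparable-adjacent : Free G 2P2 → ∀ {I} → Independent I → ∀ {x y} → Incomparable I x y → x ~ y
  incomparable-adjacent 2P2-free independent {x} {y} (x-private , y-private) with x ~? y
  ... | yes xy = xy
  ... | no ¬xy =
    let a , a∈I , xa , ¬ya = find x-private
        b , b∈I , yb , ¬xb = find y-private
    in  contradiction (induced 2P2-twinFree (quad a x b y)
          (2P2-embeds (~-sym xa) (~-sym yb) (independent a∈I b∈I) (¬ya ∘ ~-sym) ¬xb ¬xy)) 2P2-free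

  few-common-non-neighbours : ∀ ℓ → Free G (P4+ℓP1 ℓ) → ∀ {I} → Unique I → Independent I →
                              ∀ {x y} → Incomparable I x y → x ~ y →
                              length (commonNonNeighbours I x y) < ℓ
  few-common-non-neighbours ℓ P4+ℓP1-free {I} unique independent {x} {y} (x-private , y-private) xy
    with ℓ ≤? length (commonNonNeighbours I x y) | find x-private | find y-private
  ... | no few   | _ | _ = ≰⇒> few
  ... | yes many | a , a∈I , xa , ¬ya | b , b∈I , yb , ¬xb = contradiction
    (P4+isolated ℓ (path-embeds (~-sym xa) xy yb (¬ya ∘ ~-sym) ¬xb (independent a∈I b∈I))
                 w-injective (λ i j → independent (w∈I i) (w∈I j)) path≁w)
    P4+ℓP1-free
    where
    W : Vertices
    W = commonNonNeighbours I x y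

    w : Fin ℓ → Fin n
    w i = lookup W (inject≤ i many)

    w-injective : ∀ i j → w i ≡ w j → i ≡ j
    w-injective i j eq =
      Fin.inject≤-injective many many i j (Unique-lookup-injective (Unique.filter⁺ _ unique) eq)

    w-common : ∀ i → w i ∈ I × ¬ x ~ w i × ¬ y ~ w i
    w-common i = ∈-filter⁻ (neither? (x ~?_) (y ~?_)) (∈-lookup (inject≤ i many))

    w∈I : ∀ i → w i ∈ I
    w∈I = proj₁ ∘ w-common

    path≁w : ∀ i j → ¬ quad a x y b i ~ w j
    path≁w 0F j = independent a∈I (w∈I j)
    path≁w 1F j = proj₁ (proj₂ (w-common j))
    path≁w 2F j = proj₂ (proj₂ (w-common j))
    path≁w 3F j = independent b∈I (w∈I j)

  clique-bound : ∀ {k C} → Colourable G k → AllPairs _~_ C → length C ≤ k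
  clique-bound {C = C} (colour , proper) clique = ≮⇒≥ λ k<|C| →
    let i , j , i<j , same = Fin.pigeonhole k<|C| (λ i → colour (lookup C i) tt)
    in  proper _ _ tt tt (AllPairs-lookup clique i<j) same

  colour-dominated : ∀ {m u v} → u ≢ v → (∀ {x} → x ~ u → x ~ v) →
                     ColourableOn G (_≢ u) m → Colourable G m
  colour-dominated {m} {u} {v} u≢v dominated (colour , proper) = colour′ , proper′
    where
    v≢u : v ≢ u
    v≢u = u≢v ∘ ≡.sym

    colour′ : (x : Fin n) → ⊤ → Fin m
    colour′ x _ with x Fin.≟ u
    ... | yes _   = colour v v≢u
    ... | no x≢u  = colour x x≢u

    proper′ : ∀ x y (_ _ : ⊤) → adj G x y ≡ true → colour′ x tt ≢ colour′ y tt
    proper′ x y _ _ xy with x Fin.≟ u | y Fin.≟ u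
    ... | yes refl | yes refl = contradiction xy ~-irrefl
    ... | yes refl | no y≢u   = proper v y v≢u y≢u (~-sym (dominated (~-sym xy)))
    ... | no x≢u   | yes refl = proper x v x≢u v≢u (dominated xy)
    ... | no x≢u   | no y≢u   = proper x y x≢u y≢u xy

  critical-separates : ∀ {k} → VertexCritical G k → ∀ {u v} → u ≢ v → ∃[ x ] x ~ u × ¬ x ~ v
  critical-separates ((_ , not-colourable) , critical) {u} {v} u≢v
    with Fin.any? (λ x → x ~? u ×-dec ¬? (x ~? v))
  ... | yes separator = separator
  ... | no none = contradiction (colour-dominated u≢v dominated (critical u)) not-colourable
    where
    dominated : ∀ {x} → x ~ u → x ~ v
    dominated {x} xu with x ~? v
    ... | yes xv = xv
    ... | no ¬xv = contradiction (x , xu , ¬xv) none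

  order-bound : ∀ {k} ℓ → VertexCritical G k → Free G (P4+ℓP1 ℓ) → Free G 2P2 →
                n < ramseyBound (suc k) (threshold ℓ k)
  order-bound {k} ℓ critical P4+ℓP1-free 2P2-free = ≰⇒> λ bound≤n →
    [ (λ (C , _ , |C| , clique) → no-large-clique clique |C|) , no-large-independent ]′
      (ramsey _~?_ (suc k) (threshold ℓ k) (allFin n)
              (subst (_ ≤_) (≡.sym (length-tabulate id)) bound≤n))
    where
    no-large-clique : ∀ {C} → AllPairs _~_ C → length C ≢ suc k
    no-large-clique clique |C|≡1+k =
      1+n≰n (subst (_≤ k) |C|≡1+k (clique-bound (proj₁ (proj₁ critical)) clique))

    no-large-independent : Homogeneous (λ x y → ¬ x ~ y) (threshold ℓ k) (allFin n) → ⊥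
    no-large-independent (I , I⊆ , |I| , non-adjacent) =
      let C , |C| , _ , incomparable = incomparable-family ℓ k (λ _ → yes tt) unique
            (≤-reflexive (≡.sym |I|)) separated few
      in  no-large-clique
            (AllPairs.map (incomparable-adjacent 2P2-free independent) incomparable) |C|
      where
      unique : Unique I
      unique = AllPairs-resp-⊆ I⊆ (Unique.allFin⁺ n)

      independent : Independent I
      independent = AllPairs-∈ ~-irrefl (_∘ ~-sym) non-adjacent

      separated : Separated (λ _ → ⊤) I
      separated _ _ u≢v = let x , xu , ¬xv = critical-separates critical u≢v in x , tt , xu , ¬xv

      few : FewCommonNonNeighbours ℓ I
      few inc = few-common-non-neighbours ℓ P4+ℓP1-free unique independent inc
                  (incomparable-adjacent 2P2-free independent inc)

-- Enumerating all graphs of bounded order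

vectors : List A → ∀ m → List (Fin m → A)
vectors xs zero    = Vector.[] ∷ []
vectors xs (suc m) = cartesianProductWith Vector._∷_ xs (vectors xs m)

vectors-complete : ∀ {R : Rel A r} {xs} → (∀ x → Any (λ y → R y x) xs) →
                   ∀ m (v : Fin m → A) → Any (λ u → ∀ i → R (u i) (v i)) (vectors xs m)
vectors-complete complete zero    v = here λ ()
vectors-complete complete (suc m) v =
  cartesianProductWith⁺ Vector._∷_ (λ r rs → λ { zero → r ; (suc i) → rs i })
    (complete (v zero)) (vectors-complete complete m (v ∘ suc))

booleans : List Bool
booleans = true ∷ false ∷ []

booleans-complete : ∀ b → Any (_≡ b) booleans
booleans-complete true  = here refl
booleans-complete false = there (here refl)

module _ {m : ℕ} (g : Fin m → Fin m → Bool) where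

  undirected : Fin m → Fin m → Bool
  undirected x y = if does (x Fin.≟ y) then false else g x y ∧ g y x

  undirected-sym : ∀ x y → undirected x y ≡ undirected y x
  undirected-sym x y with x Fin.≟ y | y Fin.≟ x
  ... | yes _    | yes _    = refl
  ... | yes refl | no y≢x   = contradiction refl y≢x
  ... | no x≢y   | yes refl = contradiction refl x≢y
  ... | no _     | no _     = ∧-comm (g x y) (g y x)

  undirected-irrefl : ∀ x → undirected x x ≡ false
  undirected-irrefl x with x Fin.≟ x
  ... | yes _   = refl
  ... | no x≢x  = contradiction refl x≢x

  toGraph : Graph m
  toGraph = record { adj = undirected ; sym = undirected-sym ; irrefl = undirected-irrefl }

  undirected-agrees : ∀ (G : Graph m) → (∀ x y → g x y ≡ adj G x y) →
                      ∀ x y → undirected x y ≡ adj G x y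
  undirected-agrees G agree x y with x Fin.≟ y
  ... | yes refl = ≡.sym (irrefl G x)
  ... | no _     = begin
    g x y ∧ g y x             ≡⟨ cong₂ _∧_ (agree x y) (agree y x) ⟩
    adj G x y ∧ adj G y x     ≡⟨ cong (adj G x y ∧_) (sym G y x) ⟩
    adj G x y ∧ adj G x y     ≡⟨ ∧-idem (adj G x y) ⟩
    adj G x y                 ∎
    where open ≡-Reasoning

graphsOfOrder : ℕ → List AnyGraph
graphsOfOrder m = map (λ g → m , toGraph g) (vectors (vectors booleans m) m)

graphsBelow : ℕ → List AnyGraph
graphsBelow N = concatMap graphsOfOrder (upTo N)

graphsBelow-complete : ∀ {n N} → n < N → (G : Graph n) →
                       Any (λ H → Isomorphic G (proj₂ H)) (graphsBelow N)
graphsBelow-complete {n} n<N G = concatMap⁺ graphsOfOrder (applyUpTo⁺ id (map⁺ (Any.map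
  (λ {g} agree → ↔-id (Fin n) , undirected-agrees g G agree)
  (vectors-complete (vectors-complete booleans-complete n) n (adj G)))) n<N)

-- The bound on the order holds for every k.
theorem2 : (k ℓ : ℕ) → k ≥ 1 →
    Σ (List AnyGraph) λ L →
    ∀ (n : ℕ) (G : Graph n) →
    VertexCritical G k → Free G (P4+ℓP1 ℓ) → Free G 2P2 →
    Any (λ H → Isomorphic G (proj₂ H)) L
theorem2 k ℓ _ = graphsBelow (ramseyBound (suc k) (threshold ℓ k)) ,
  λ n G critical P4+ℓP1-free 2P2-free →
    graphsBelow-complete (order-bound G ℓ critical P4+ℓP1-free 2P2-free) G
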